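{- Let $n$ and $m$ be positive integers with $\frac{2}{3}n<m<n$ and $n\ge 7$. Let $G$ be the graph obtained from the Cartesian product $K_n\square P_2$ (two disjoint copies of $K_n$ with vertices $v_{1,1},\dots,v_{1,n}$ and $v_{2,1},\dots,v_{2,n}$, joined by the perfect matching $v_{1,j}v_{2,j}$, $1\le j\le n$) by deleting $n-m$ of the matching edges $v_{1,j}v_{2,j}$, so that exactly $m$ of them remain. Then $G$ is a claw-free, minimally $\frac{m}{2}$-tough graph with $\delta(G)=\Delta(G)-1=n-1$.
   Context: All graphs are finite and simple. $K_n$ is the complete graph and $P_2$ the path on $2$ vertices; $K_n\square P_2$ is their Cartesian product. A graph is claw-free if it contains no induced $K_{1,3}$. $\delta(G)$ and $\Delta(G)$ denote minimum and maximum degree. For a graph $G$, $\omega(G)$ denotes the number of components. For a positive real $t$, $G$ is $t$-tough if $\omega(G\setminus S)\le \max\{1,|S|/t\}$ for every $S\subseteq V(G)$; the toughness $t(G)$ is the largest such $t$. $G$ is minimally $t$-tough if $t(G)=t$ and $G-e$ is not $t$-tough for every edge $e\in E(G)$.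
   Formalization: The parameter t of t-toughness, including the candidate values compared in the toughness $t(G)$, ranges over the positive rationals rather than the positive reals. -}

module Defs where

open import Data.Bool using (Bool; true; false; _∧_; _∨_; not)
open import Data.Nat as ℕ using (ℕ; _≤_)
open import Data.Integer using (+_)
open import Data.Fin using (Fin; splitAt)
open import Data.Fin.Properties using (_≟_)
open import Data.Fin.Subset using (Subset; _∈_; _∉_; ∣_∣)
open import Data.Vec using (tabulate)
open import Data.Sum using (_⊎_; inj₁; inj₂)
open import Data.Product using (Σ; ∃; _×_; _,_)
open import Data.Empty using (⊥)
open import Relation.Nullary using (¬_; ⌊_⌋)
open import Relation.Binary.PropositionalEquality using (_≡_; _≢_)
open import Function.Definitions using (Surjective)
open import Function.Bundles using (_⇔_)
open import Data.Rational as ℚ using (ℚ; 0ℚ; 1ℚ; _⊔_; _÷_; positive)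
open import Data.Rational.Properties using (pos⇒nonZero)

Graph : ℕ → Set
Graph N = Fin N → Fin N → Bool

Adj : ∀ {N} → Graph N → Fin N → Fin N → Set
Adj G u v = G u v ≡ true

IsSimple : ∀ {N} → Graph N → Set
IsSimple G = (∀ u v → G u v ≡ G v u) × (∀ v → G v v ≡ false)

removeEdge : ∀ {N} → Graph N → Fin N → Fin N → Graph N
removeEdge G a b u v =
  G u v ∧ not ((⌊ u ≟ a ⌋ ∧ ⌊ v ≟ b ⌋) ∨ (⌊ u ≟ b ⌋ ∧ ⌊ v ≟ a ⌋))

deg : ∀ {N} → Graph N → Fin N → ℕ
deg G v = ∣ tabulate (G v) ∣

IsMinDegree : ∀ {N} → Graph N → ℕ → Set
IsMinDegree G d = (∀ v → d ≤ deg G v) × ∃ λ v → deg G v ≡ d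

IsMaxDegree : ∀ {N} → Graph N → ℕ → Set
IsMaxDegree G d = (∀ v → deg G v ≤ d) × ∃ λ v → deg G v ≡ d

ClawFree : ∀ {N} → Graph N → Set
ClawFree G = ∀ c a b d → a ≢ b → a ≢ d → b ≢ d →
  Adj G c a → Adj G c b → Adj G c d →
  ¬ Adj G a b → ¬ Adj G a d → ¬ Adj G b d → ⊥

-- Walks in G ∖ S (all vertices after the first avoid S).
data Walk {N} (G : Graph N) (S : Subset N) : Fin N → Fin N → Set where
  here : ∀ {u} → Walk G S u u
  step : ∀ {u w v} → Adj G u w → w ∉ S → Walk G S w v → Walk G S u v

VertOut : ∀ {N} → Subset N → Set
VertOut {N} S = Σ (Fin N) (λ v → v ∉ S)

-- G ∖ S has exactly k components: a surjective labelling of the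
-- vertices of G ∖ S by Fin k whose fibres are exactly the
-- connectivity classes of G ∖ S.
Components : ∀ {N} → Graph N → Subset N → ℕ → Set
Components {N} G S k =
  Σ (VertOut S → Fin k) λ f →
    Surjective _≡_ _≡_ f ×
    (∀ (u v : VertOut S) → (f u ≡ f v) ⇔ Walk G S (Data.Product.proj₁ u) (Data.Product.proj₁ v))

ℕtoℚ : ℕ → ℚ
ℕtoℚ k = + k ℚ./ 1

-- G is t-tough (t a positive rational):
-- ω(G ∖ S) ≤ max{1, |S|/t} for every S ⊆ V(G).
Tough : ∀ {N} → Graph N → (t : ℚ) → 0ℚ ℚ.< t → Set
Tough {N} G t pos = ∀ (S : Subset N) (k : ℕ) → Components G S k →
  ℕtoℚ k ℚ.≤ (1ℚ ⊔ (_÷_ (ℕtoℚ ∣ S ∣) t {{pos⇒nonZero t {{positive pos}}}}))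

ToughnessIs : ∀ {N} → Graph N → (t : ℚ) → 0ℚ ℚ.< t → Set
ToughnessIs G t pos = Tough G t pos ×
  (∀ t' (pos' : 0ℚ ℚ.< t') → t ℚ.< t' → ¬ Tough G t' pos')

MinimallyTough : ∀ {N} → Graph N → (t : ℚ) → 0ℚ ℚ.< t → Set
MinimallyTough G t pos = ToughnessIs G t pos ×
  (∀ a b → Adj G a b → ¬ Tough (removeEdge G a b) t pos)

-- The graph of the theorem: K_n □ P_2 on Fin (n + n), where vertex
-- i ↑ˡ n is v_{1,i} and n ↑ʳ i is v_{2,i}; the matching edge
-- v_{1,j} v_{2,j} is kept iff j ∈ M.
KnP2Minus : (n : ℕ) → Subset n → Graph (n ℕ.+ n)
KnP2Minus n M u v with splitAt n u | splitAt n v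
... | inj₁ i | inj₁ j = not ⌊ i ≟ j ⌋
... | inj₂ i | inj₂ j = not ⌊ i ≟ j ⌋
... | inj₁ i | inj₂ j = ⌊ i ≟ j ⌋ ∧ Data.Vec.lookup M i
... | inj₂ i | inj₁ j = ⌊ i ≟ j ⌋ ∧ Data.Vec.lookup M i

-- The two copies of K_n are cliques covering G, so G is claw-free and G ∖ S has at
-- most two components.  If it has two, no matching edge v₁ⱼv₂ⱼ survives in G ∖ S,
-- so |S| ≥ m and ω(G ∖ S) = 2 ≤ |S|/(m/2): G is m/2-tough.  Deleting the m matched
-- vertices of the first copy leaves two components (an unmatched index exists as
-- m < n), so t(G) = m/2.  Minimality: without a matching edge v₁ᵢv₂ᵢ, the other
-- m − 1 matched vertices of the first copy already separate; without a clique edge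
-- v_{σ,i}v_{σ,j}, deleting the other n − 2 vertices of copy σ together with v_{¬σ,i}
-- and v_{¬σ,j} leaves three components, and 3 > n/(m/2) because 2n < 3m.

module Submission where

open import Defs
open import Data.Nat using (ℕ; _+_; _*_; _<_; _≤_; _∸_)
open import Data.Integer using (+_)
open import Data.Product using (_×_)
open import Relation.Binary.PropositionalEquality using (_≡_)
open import Data.Fin.Subset using (Subset; ∣_∣)
open import Data.Rational using (0ℚ; _/_) renaming (_<_ to _<ℚ_)

open import Data.Bool using (Bool; true; false; not; _∧_; _∨_; if_then_else_)
open import Data.Bool.Properties using (∧-identityʳ; ∧-zeroʳ; not-¬) renaming (_≟_ to _≟ᵇ_)
open import Data.Empty using (⊥-elim)
open import Data.Fin using (Fin; zero; suc; _↑ˡ_; _↑ʳ_; splitAt)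
open import Data.Fin.Properties
  using (_≟_; 0≢1+n; nonZeroIndex; 2↔Bool; splitAt-↑ˡ; splitAt-↑ʳ; splitAt⁻¹-↑ˡ; splitAt⁻¹-↑ʳ)
open import Data.Fin.Subset using (_∈_; _∉_; _⊆_; _∪_; ∁; ⁅_⁆; _-_; Nonempty) renaming (⊥ to ∅)
open import Data.Fin.Subset.Properties
  using ( _∈?_; nonempty?; Empty-unique; ∉⊥; x∈⁅x⁆; x∈⁅y⁆⇒x≡y; x∈∁p⇒x∉p; x∉∁p⇒x∈p
        ; x∈p∪q⁺; x∈p∪q⁻; x∈p∧x≢y⇒x∈p-y; p─q⊆p
        ; ∣⊥∣≡0; ∣⁅x⁆∣≡1; ∣p∣≤n; ∣∁p∣≡n∸∣p∣; p⊆q⇒∣p∣≤∣q∣; x∈p⇒∣p-x∣<∣p∣)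
import Data.Integer as ℤ
import Data.Integer.Properties as ℤP
open import Data.Nat using (suc; z≤n; s≤s)
open import Data.Nat.Properties
  using ( ≤-refl; ≤-reflexive; ≤-trans; <-irrefl; n≤1+n; module ≤-Reasoning
        ; +-comm; +-suc; +-identityʳ; +-monoʳ-≤; *-comm; *-monoʳ-≤; *-monoˡ-<
        ; m∸n≤m; m∸n+n≡m; m<n⇒0<n∸m; suc-pred)
open import Data.Product using (∃; _,_; proj₁; proj₂)
open import Data.Rational as ℚ using (ℚ; 1ℚ; toℚᵘ)
import Data.Rational.Properties as ℚP
import Data.Rational.Unnormalised as ℚᵘ
open ℚᵘ using (mkℚᵘ) renaming (_≃_ to _≃ᵘ_)
import Data.Rational.Unnormalised.Properties as ℚᵘP
open import Data.Sum as Sum using (_⊎_; inj₁; inj₂; [_,_]′)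
open import Data.Vec as Vec using (Vec; []; _∷_; _++_; lookup; tabulate; replicate)
open import Data.Vec.Properties
  using ( tabulate-∘; tabulate-cong; lookup∘tabulate; lookup-replicate; lookup-++ˡ; lookup-++ʳ
        ; []=⇒lookup; lookup⇒[]=)
open import Function using (_∘_; const; id)
open import Function.Bundles using (_⇔_; mk⇔; Equivalence; Inverse)
open import Relation.Binary.PropositionalEquality
  using (_≢_; refl; sym; trans; cong; cong₂; subst; subst₂; module ≡-Reasoning)
open import Relation.Nullary using (¬_; ⌊_⌋; yes; no; Dec; does; _×-dec_; _⊎-dec_)
open import Relation.Nullary.Decidable using (⌊⌋-map′; isYes≗does)

∣p++q∣≡∣p∣+∣q∣ : ∀ {m n} (p : Subset m) (q : Subset n) → ∣ p ++ q ∣ ≡ ∣ p ∣ + ∣ q ∣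
∣p++q∣≡∣p∣+∣q∣ []          q = refl
∣p++q∣≡∣p∣+∣q∣ (true  ∷ p) q = cong suc (∣p++q∣≡∣p∣+∣q∣ p q)
∣p++q∣≡∣p∣+∣q∣ (false ∷ p) q = ∣p++q∣≡∣p∣+∣q∣ p q

∣p∪q∣≤∣p∣+∣q∣ : ∀ {n} (p q : Subset n) → ∣ p ∪ q ∣ ≤ ∣ p ∣ + ∣ q ∣
∣p∪q∣≤∣p∣+∣q∣ []          []          = z≤n
∣p∪q∣≤∣p∣+∣q∣ (true  ∷ p) (true  ∷ q) = s≤s (≤-trans (∣p∪q∣≤∣p∣+∣q∣ p q) (+-monoʳ-≤ ∣ p ∣ (n≤1+n ∣ q ∣)))
∣p∪q∣≤∣p∣+∣q∣ (true  ∷ p) (false ∷ q) = s≤s (∣p∪q∣≤∣p∣+∣q∣ p q)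
∣p∪q∣≤∣p∣+∣q∣ (false ∷ p) (true  ∷ q) = ≤-trans (s≤s (∣p∪q∣≤∣p∣+∣q∣ p q)) (≤-reflexive (sym (+-suc _ _)))
∣p∪q∣≤∣p∣+∣q∣ (false ∷ p) (false ∷ q) = ∣p∪q∣≤∣p∣+∣q∣ p q

tabulate-false : ∀ n → tabulate {n = n} (const false) ≡ ∅
tabulate-false 0       = refl
tabulate-false (suc n) = cong (false ∷_) (tabulate-false n)

tabulate-++ : ∀ {A : Set} m {n} (f : Fin (m + n) → A) →
  tabulate f ≡ tabulate (f ∘ (_↑ˡ n)) ++ tabulate (f ∘ (m ↑ʳ_))
tabulate-++ 0       f = refl
tabulate-++ (suc m) f = cong (f zero ∷_) (tabulate-++ m (f ∘ suc))

-- ⌊_⌋ is isYes, which does not compute through map′, hence ⌊⌋-map′.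
tabulate-≟ : ∀ {n} (i : Fin n) → tabulate (λ j → ⌊ i ≟ j ⌋) ≡ ⁅ i ⁆
tabulate-≟ zero    = cong (true ∷_) (tabulate-false _)
tabulate-≟ (suc i) = cong (false ∷_) (trans (tabulate-cong (λ x → ⌊⌋-map′ _ _ (i ≟ x))) (tabulate-≟ i))

0<∣p∣⇒Nonempty : ∀ {n} (p : Subset n) → 0 < ∣ p ∣ → Nonempty p
0<∣p∣⇒Nonempty {n} p 0<∣p∣ with nonempty? p
... | yes p≢∅ = p≢∅
... | no p-empty with Empty-unique p-empty
... | refl = ⊥-elim (<-irrefl (sym (∣⊥∣≡0 n)) 0<∣p∣)

∣p∣<n⇒Nonempty∁p : ∀ {n} (p : Subset n) → ∣ p ∣ < n → Nonempty (∁ p)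
∣p∣<n⇒Nonempty∁p {n} p ∣p∣<n = 0<∣p∣⇒Nonempty (∁ p) (subst (0 <_) (sym (∣∁p∣≡n∸∣p∣ p)) (m<n⇒0<n∸m ∣p∣<n))

lookup≡⇒∈⇔∈ : ∀ {m n} {p : Subset m} {q : Subset n} {x y} → lookup p x ≡ lookup q y → x ∈ p ⇔ y ∈ q
lookup≡⇒∈⇔∈ {p = p} {q} {x} {y} eq =
  mk⇔ (λ x∈p → lookup⇒[]= y q (trans (sym eq) ([]=⇒lookup x∈p)))
      (λ y∈q → lookup⇒[]= x p (trans eq ([]=⇒lookup y∈q)))

∉⇒lookup≡false : ∀ {n} {p : Subset n} {x} → x ∉ p → lookup p x ≡ false
∉⇒lookup≡false {p = p} {x} x∉p with lookup p x in eq
... | true  = ⊥-elim (x∉p (lookup⇒[]= x p eq))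
... | false = refl

pigeonhole : (x y z : Bool) → x ≡ y ⊎ x ≡ z ⊎ y ≡ z
pigeonhole true  true  _     = inj₁ refl
pigeonhole false false _     = inj₁ refl
pigeonhole true  false true  = inj₂ (inj₁ refl)
pigeonhole false true  false = inj₂ (inj₁ refl)
pigeonhole true  false false = inj₂ (inj₂ refl)
pigeonhole false true  true  = inj₂ (inj₂ refl)

≢⇒≡⊎≡ : ∀ {y z : Bool} → y ≢ z → ∀ x → x ≡ y ⊎ x ≡ z
≢⇒≡⊎≡ {y} {z} y≢z x with pigeonhole x y z
... | inj₁ x≡y        = inj₁ x≡y
... | inj₂ (inj₁ x≡z) = inj₂ x≡z
... | inj₂ (inj₂ y≡z) = ⊥-elim (y≢z y≡z)

Ends : ∀ {N} → Fin N → Fin N → Fin N → Fin N → Set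
Ends a b u v = (u ≡ a × v ≡ b) ⊎ (u ≡ b × v ≡ a)

module _ {N : ℕ} {G : Graph N} where

  removeEdge-Adj : ∀ {a b u v} → Adj (removeEdge G a b) u v ⇔ (Adj G u v × ¬ Ends a b u v)
  removeEdge-Adj {a} {b} {u} {v} =
    subst (λ x → (x ≡ true) ⇔ (Adj G u v × ¬ Ends a b u v)) (sym removeEdge≡) (∧-not-does (G u v) ends?)
    where
    ends? : Dec (Ends a b u v)
    ends? = (u ≟ a ×-dec v ≟ b) ⊎-dec (u ≟ b ×-dec v ≟ a)

    removeEdge≡ : removeEdge G a b u v ≡ G u v ∧ not (does ends?)
    removeEdge≡ = cong (λ e → G u v ∧ not e)
      (cong₂ _∨_ (cong₂ _∧_ (isYes≗does (u ≟ a)) (isYes≗does (v ≟ b)))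
                 (cong₂ _∧_ (isYes≗does (u ≟ b)) (isYes≗does (v ≟ a))))

    ∧-not-does : ∀ {P : Set} x (d : Dec P) → (x ∧ not (does d) ≡ true) ⇔ (x ≡ true × ¬ P)
    ∧-not-does true  (yes p) = mk⇔ (λ ()) (λ (_ , ¬p) → ⊥-elim (¬p p))
    ∧-not-does true  (no ¬p) = mk⇔ (λ _ → refl , ¬p) (λ _ → refl)
    ∧-not-does false _       = mk⇔ (λ ()) (λ ())

  module _ {S : Subset N} where

    Components⇒sameLabel : ∀ {k} (C : Components G S k) (u v : VertOut S) →
      proj₁ u ≡ proj₁ v ⊎ Adj G (proj₁ u) (proj₁ v) → proj₁ C u ≡ proj₁ C v
    Components⇒sameLabel (_ , _ , walk⇔) u v (inj₁ refl) = Equivalence.from (walk⇔ u v) here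
    Components⇒sameLabel (_ , _ , walk⇔) u v (inj₂ u~v)  =
      Equivalence.from (walk⇔ u v) (step u~v (proj₂ v) here)

    Components⇒representative : ∀ {k} (C : Components G S k) (y : Fin k) → ∃ λ u → proj₁ C u ≡ y
    Components⇒representative (_ , surjective , _) y = proj₁ (surjective y) , proj₂ (surjective y) refl

    labelling⇒Components : ∀ {k} (f : Fin N → Fin k) →
      (∀ u w → Adj G u w → u ∉ S → w ∉ S → f u ≡ f w) →
      (∀ u v → u ∉ S → v ∉ S → f u ≡ f v → u ≡ v ⊎ Adj G u v) →
      (∀ y → ∃ λ u → u ∉ S × f u ≡ y) →
      Components G S k
    labelling⇒Components {k} f edge⇒≡ ≡⇒edge hit =
      f ∘ proj₁ , surjective , λ u v → mk⇔ (≡⇒walk u v) (walk⇒≡ (proj₂ u))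
      where
      surjective : ∀ y → ∃ λ (u : VertOut S) → ∀ {z} → z ≡ u → f (proj₁ z) ≡ y
      surjective y with hit y
      ... | u , u∉S , fu≡y = (u , u∉S) , λ { refl → fu≡y }

      ≡⇒walk : ∀ (u v : VertOut S) → f (proj₁ u) ≡ f (proj₁ v) → Walk G S (proj₁ u) (proj₁ v)
      ≡⇒walk (u , u∉S) (v , v∉S) fu≡fv with ≡⇒edge u v u∉S v∉S fu≡fv
      ... | inj₁ refl = here
      ... | inj₂ u~v  = step u~v v∉S here

      walk⇒≡ : ∀ {u v} → u ∉ S → Walk G S u v → f u ≡ f v
      walk⇒≡ _   here                = refl
      walk⇒≡ u∉S (step u~w w∉S walk) = trans (edge⇒≡ _ _ u~w u∉S w∉S) (walk⇒≡ w∉S walk)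

-- Graphs covered by two cliques

TwoCliqueCover : ∀ {N} → Graph N → (Fin N → Bool) → Set
TwoCliqueCover G c = ∀ u v → c u ≡ c v → u ≡ v ⊎ Adj G u v

module _ {N : ℕ} {G : Graph N} {c : Fin N → Bool} (cover : TwoCliqueCover G c) where

  TwoCliqueCover⇒ClawFree : ClawFree G
  TwoCliqueCover⇒ClawFree _ a b d a≢b a≢d b≢d _ _ _ a≁b a≁d b≁d with pigeonhole (c a) (c b) (c d)
  ... | inj₁ ca≡cb        = [ a≢b , a≁b ]′ (cover a b ca≡cb)
  ... | inj₂ (inj₁ ca≡cd) = [ a≢d , a≁d ]′ (cover a d ca≡cd)
  ... | inj₂ (inj₂ cb≡cd) = [ b≢d , b≁d ]′ (cover b d cb≡cd)

  removeEdge-TwoCliqueCover : ∀ {a b} → c a ≢ c b → TwoCliqueCover (removeEdge G a b) c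
  removeEdge-TwoCliqueCover {a} {b} ca≢cb u v cu≡cv with cover u v cu≡cv
  ... | inj₁ u≡v = inj₁ u≡v
  ... | inj₂ u~v = inj₂ (Equivalence.from (removeEdge-Adj {G = G}) (u~v , not-ends))
    where
    not-ends : ¬ Ends a b u v
    not-ends (inj₁ (refl , refl)) = ca≢cb cu≡cv
    not-ends (inj₂ (refl , refl)) = ca≢cb (sym cu≡cv)

  module _ {S : Subset N} where

    sameClique⇒sameLabel : ∀ {k} (C : Components G S k) (u v : VertOut S) →
      c (proj₁ u) ≡ c (proj₁ v) → proj₁ C u ≡ proj₁ C v
    sameClique⇒sameLabel C u v cu≡cv = Components⇒sameLabel C u v (cover _ _ cu≡cv)

    TwoCliqueCover⇒components≤2 : ∀ {k} → Components G S k → k ≤ 2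
    TwoCliqueCover⇒components≤2 {0}                   _ = z≤n
    TwoCliqueCover⇒components≤2 {1}                   _ = s≤s z≤n
    TwoCliqueCover⇒components≤2 {2}                   _ = s≤s (s≤s z≤n)
    TwoCliqueCover⇒components≤2 {suc (suc (suc k))} C
      with Components⇒representative C zero | Components⇒representative C (suc zero)
         | Components⇒representative C (suc (suc zero))
    ... | u₀ , f₀ | u₁ , f₁ | u₂ , f₂ with pigeonhole (c (proj₁ u₀)) (c (proj₁ u₁)) (c (proj₁ u₂))
    ... | inj₁ e        with () ← trans (sym f₀) (trans (sameClique⇒sameLabel C u₀ u₁ e) f₁)
    ... | inj₂ (inj₁ e) with () ← trans (sym f₀) (trans (sameClique⇒sameLabel C u₀ u₂ e) f₂)
    ... | inj₂ (inj₂ e) with () ← trans (sym f₁) (trans (sameClique⇒sameLabel C u₁ u₂ e) f₂)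

    crossEdge⇒sameLabel : ∀ {k} (C : Components G S k) {u w} (u∉S : u ∉ S) (w∉S : w ∉ S) →
      Adj G u w → c u ≢ c w → ∀ x → proj₁ C x ≡ proj₁ C (u , u∉S)
    crossEdge⇒sameLabel C {u} {w} u∉S w∉S u~w cu≢cw x with ≢⇒≡⊎≡ cu≢cw (c (proj₁ x))
    ... | inj₁ cx≡cu = sameClique⇒sameLabel C x (u , u∉S) cx≡cu
    ... | inj₂ cx≡cw = trans (sameClique⇒sameLabel C x (w , w∉S) cx≡cw)
                             (sym (Components⇒sameLabel C (u , u∉S) (w , w∉S) (inj₂ u~w)))

    twoComponents⇒crossEdge∩S : Components G S 2 → ∀ {u w} → Adj G u w → c u ≢ c w → u ∈ S ⊎ w ∈ S
    twoComponents⇒crossEdge∩S C {u} {w} u~w cu≢cw with u ∈? S | w ∈? S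
    ... | yes u∈S | _       = inj₁ u∈S
    ... | no _    | yes w∈S = inj₂ w∈S
    ... | no u∉S  | no w∉S
      with Components⇒representative C zero | Components⇒representative C (suc zero)
    ... | x₀ , Cx₀≡0 | x₁ , Cx₁≡1 = ⊥-elim (0≢1+n (begin
      zero               ≡⟨ sym Cx₀≡0 ⟩
      proj₁ C x₀         ≡⟨ crossEdge⇒sameLabel C u∉S w∉S u~w cu≢cw x₀ ⟩
      proj₁ C (u , u∉S)  ≡⟨ crossEdge⇒sameLabel C u∉S w∉S u~w cu≢cw x₁ ⟨
      proj₁ C x₁         ≡⟨ Cx₁≡1 ⟩
      suc zero           ∎))
      where open ≡-Reasoning

    sides⇒twoComponents : (∀ u w → Adj G u w → u ∉ S → w ∉ S → c u ≡ c w) →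
      (∃ λ u → u ∉ S × c u ≡ false) → (∃ λ u → u ∉ S × c u ≡ true) → Components G S 2
    sides⇒twoComponents edge⇒≡ (u₀ , u₀∉S , cu₀) (u₁ , u₁∉S , cu₁) =
      labelling⇒Components (from ∘ c) (λ u w u~w u∉S w∉S → cong from (edge⇒≡ u w u~w u∉S w∉S))
        (λ u v _ _ fu≡fv → cover u v (from-injective fu≡fv)) hit
      where
      open Inverse 2↔Bool using (from; to; strictlyInverseˡ)
      from-injective : ∀ {x y} → from x ≡ from y → x ≡ y
      from-injective {x} {y} eq = trans (sym (strictlyInverseˡ x)) (trans (cong to eq) (strictlyInverseˡ y))
      hit : ∀ y → ∃ λ u → u ∉ S × from (c u) ≡ y
      hit zero       = u₀ , u₀∉S , cong from cu₀
      hit (suc zero) = u₁ , u₁∉S , cong from cu₁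

module _ (t : ℚ) (t>0 : 0ℚ <ℚ t) where
  -- t-nonZero unfolds to the NonZero instance used in the definition of Tough.
  private instance
    t-positive : ℚ.Positive t
    t-positive = ℚ.positive t>0
    t-nonZero : ℚ.NonZero t
    t-nonZero = ℚP.pos⇒nonZero t
    t⁻¹-nonNegative : ℚ.NonNegative (ℚ.1/ t)
    t⁻¹-nonNegative = ℚP.pos⇒nonNeg (ℚ.1/ t) {{ℚP.1/pos⇒pos t}}
    t⁻¹-positive : ℚ.Positive (ℚ.1/ t)
    t⁻¹-positive = ℚP.1/pos⇒pos t

  *÷-cancel : ∀ r → (r ℚ.* t) ℚ.÷ t ≡ r
  *÷-cancel r = begin
    r ℚ.* t ℚ.* ℚ.1/ t    ≡⟨ ℚP.*-assoc r t (ℚ.1/ t) ⟩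
    r ℚ.* (t ℚ.* ℚ.1/ t)  ≡⟨ cong (r ℚ.*_) (ℚP.*-inverseʳ t) ⟩
    r ℚ.* 1ℚ              ≡⟨ ℚP.*-identityʳ r ⟩
    r                     ∎
    where open ≡-Reasoning

  ≤1⊔÷ : ∀ {r p} → r ℚ.≤ 1ℚ ⊎ r ℚ.* t ℚ.≤ p → r ℚ.≤ 1ℚ ℚ.⊔ (p ℚ.÷ t)
  ≤1⊔÷ {r} {p} (inj₁ r≤1)  = ℚP.≤-trans r≤1 (ℚP.p≤p⊔q 1ℚ (p ℚ.÷ t))
  ≤1⊔÷ {r} {p} (inj₂ rt≤p) =
    ℚP.≤-trans (subst (ℚ._≤ p ℚ.÷ t) (*÷-cancel r) (ℚP.*-monoʳ-≤-nonNeg (ℚ.1/ t) rt≤p)) (ℚP.p≤q⊔p 1ℚ (p ℚ.÷ t))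

  ≰1⊔÷ : ∀ {r p} → 1ℚ <ℚ r → p <ℚ r ℚ.* t → ¬ r ℚ.≤ 1ℚ ℚ.⊔ (p ℚ.÷ t)
  ≰1⊔÷ {r} {p} 1<r p<rt r≤max with ℚP.⊔-sel 1ℚ (p ℚ.÷ t)
  ... | inj₁ max≡1 = ℚP.<-irrefl refl (ℚP.<-≤-trans 1<r (subst (r ℚ.≤_) max≡1 r≤max))
  ... | inj₂ max≡÷ = ℚP.<-irrefl refl (ℚP.<-≤-trans p÷t<r (subst (r ℚ.≤_) max≡÷ r≤max))
    where
    p÷t<r : p ℚ.÷ t <ℚ r
    p÷t<r = subst (p ℚ.÷ t <ℚ_) (*÷-cancel r) (ℚP.*-monoˡ-<-pos (ℚ.1/ t) p<rt)

toℚᵘ-ℕtoℚ : ∀ s → toℚᵘ (ℕtoℚ s) ≃ᵘ mkℚᵘ (+ s) 0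
toℚᵘ-ℕtoℚ s = ℚP.toℚᵘ-fromℚᵘ (mkℚᵘ (+ s) 0)

toℚᵘ-ℕtoℚ*half : ∀ k m → toℚᵘ (ℕtoℚ k ℚ.* (+ m / 2)) ≃ᵘ mkℚᵘ (+ (k * m)) 1
toℚᵘ-ℕtoℚ*half k m = ℚᵘP.≃-trans (ℚP.toℚᵘ-homo-* (ℕtoℚ k) (+ m / 2))
  (ℚᵘP.≃-trans (ℚᵘP.*-cong (toℚᵘ-ℕtoℚ k) (ℚP.toℚᵘ-fromℚᵘ (mkℚᵘ (+ m) 1)))
               (ℚᵘ.*≡* (cong (ℤ._* + 2) (sym (ℤP.pos-* k m)))))

private
  cancel-≤ : ∀ {p q p′ q′} → toℚᵘ p ≃ᵘ p′ → toℚᵘ q ≃ᵘ q′ → p′ ℚᵘ.≤ q′ → p ℚ.≤ q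
  cancel-≤ p≃ q≃ p′≤q′ = ℚP.toℚᵘ-cancel-≤ (ℚᵘP.≤-respˡ-≃ (ℚᵘP.≃-sym p≃) (ℚᵘP.≤-respʳ-≃ (ℚᵘP.≃-sym q≃) p′≤q′))

  cancel-< : ∀ {p q p′ q′} → toℚᵘ p ≃ᵘ p′ → toℚᵘ q ≃ᵘ q′ → p′ ℚᵘ.< q′ → p <ℚ q
  cancel-< p≃ q≃ p′<q′ = ℚP.toℚᵘ-cancel-< (ℚᵘP.<-respˡ-≃ (ℚᵘP.≃-sym p≃) (ℚᵘP.<-respʳ-≃ (ℚᵘP.≃-sym q≃) p′<q′))

  +x*+1≡+x : ∀ x → + x ℤ.* + 1 ≡ + x
  +x*+1≡+x x = ℤP.*-identityʳ (+ x)

  +x*+2≡+[x*2] : ∀ x → + x ℤ.* + 2 ≡ + (x * 2)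
  +x*+2≡+[x*2] x = sym (ℤP.pos-* x 2)

ℕtoℚ-mono-≤ : ∀ {a b} → a ≤ b → ℕtoℚ a ℚ.≤ ℕtoℚ b
ℕtoℚ-mono-≤ {a} {b} a≤b = cancel-≤ (toℚᵘ-ℕtoℚ a) (toℚᵘ-ℕtoℚ b)
  (ℚᵘ.*≤* (subst₂ ℤ._≤_ (sym (+x*+1≡+x a)) (sym (+x*+1≡+x b)) (ℤ.+≤+ a≤b)))

ℕtoℚ-mono-< : ∀ {a b} → a < b → ℕtoℚ a <ℚ ℕtoℚ b
ℕtoℚ-mono-< {a} {b} a<b = cancel-< (toℚᵘ-ℕtoℚ a) (toℚᵘ-ℕtoℚ b)
  (ℚᵘ.*<* (subst₂ ℤ._<_ (sym (+x*+1≡+x a)) (sym (+x*+1≡+x b)) (ℤ.+<+ a<b)))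

ℕtoℚ*half≤ℕtoℚ : ∀ {k m s} → k * m ≤ s * 2 → ℕtoℚ k ℚ.* (+ m / 2) ℚ.≤ ℕtoℚ s
ℕtoℚ*half≤ℕtoℚ {k} {m} {s} km≤2s = cancel-≤ (toℚᵘ-ℕtoℚ*half k m) (toℚᵘ-ℕtoℚ s)
  (ℚᵘ.*≤* (subst₂ ℤ._≤_ (sym (+x*+1≡+x (k * m))) (sym (+x*+2≡+[x*2] s)) (ℤ.+≤+ km≤2s)))

ℕtoℚ≤ℕtoℚ*half : ∀ {k m s} → s * 2 ≤ k * m → ℕtoℚ s ℚ.≤ ℕtoℚ k ℚ.* (+ m / 2)
ℕtoℚ≤ℕtoℚ*half {k} {m} {s} 2s≤km = cancel-≤ (toℚᵘ-ℕtoℚ s) (toℚᵘ-ℕtoℚ*half k m)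
  (ℚᵘ.*≤* (subst₂ ℤ._≤_ (sym (+x*+2≡+[x*2] s)) (sym (+x*+1≡+x (k * m))) (ℤ.+≤+ 2s≤km)))

ℕtoℚ<ℕtoℚ*half : ∀ {k m s} → s * 2 < k * m → ℕtoℚ s <ℚ ℕtoℚ k ℚ.* (+ m / 2)
ℕtoℚ<ℕtoℚ*half {k} {m} {s} 2s<km = cancel-< (toℚᵘ-ℕtoℚ s) (toℚᵘ-ℕtoℚ*half k m)
  (ℚᵘ.*<* (subst₂ ℤ._<_ (sym (+x*+2≡+[x*2] s)) (sym (+x*+1≡+x (k * m))) (ℤ.+<+ 2s<km)))

module _ {N : ℕ} {G : Graph N} where

  Tough-half : ∀ {m} (pos : 0ℚ <ℚ + m / 2) →
    (∀ S k → Components G S k → k ≤ 1 ⊎ k * m ≤ ∣ S ∣ * 2) → Tough G (+ m / 2) pos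
  Tough-half {m} pos bound S k C =
    ≤1⊔÷ _ pos (Sum.map (ℕtoℚ-mono-≤ {k} {1}) (ℕtoℚ*half≤ℕtoℚ {k} {m} {∣ S ∣}) (bound S k C))

  ¬Tough : ∀ {t} (pos : 0ℚ <ℚ t) {S k} → Components G S k → 1 < k →
    ℕtoℚ ∣ S ∣ <ℚ ℕtoℚ k ℚ.* t → ¬ Tough G t pos
  ¬Tough pos C 1<k ∣S∣<kt tough = ≰1⊔÷ _ pos (ℕtoℚ-mono-< 1<k) ∣S∣<kt (tough _ _ C)

-- The graph K_n □ P₂ minus matching edges

module Prism (n : ℕ) where

  vtx : Bool → Fin n → Fin (n + n)
  vtx true  i = i ↑ˡ n
  vtx false i = n ↑ʳ i

  side : Fin (n + n) → Bool
  side u = [ const true , const false ]′ (splitAt n u)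

  side-vtx : ∀ σ i → side (vtx σ i) ≡ σ
  side-vtx true  i rewrite splitAt-↑ˡ n i n = refl
  side-vtx false i rewrite splitAt-↑ʳ n n i = refl

  side-own≢other : ∀ σ i j → side (vtx σ i) ≢ side (vtx (not σ) j)
  side-own≢other σ i j eq = not-¬ refl (trans (sym (side-vtx σ i)) (trans eq (side-vtx (not σ) j)))

  vtx-other≢vtx : ∀ σ {i j} → vtx (not σ) i ≢ vtx σ j
  vtx-other≢vtx σ {i} {j} eq = side-own≢other σ j i (cong side (sym eq))

  data Vertex : Fin (n + n) → Set where
    vertex : ∀ σ i → Vertex (vtx σ i)

  toVertex : ∀ u → Vertex u
  toVertex u with splitAt n u in eq
  ... | inj₁ i = subst Vertex (splitAt⁻¹-↑ˡ eq) (vertex true i)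
  ... | inj₂ i = subst Vertex (splitAt⁻¹-↑ʳ eq) (vertex false i)

  data Relative (σ : Bool) : Fin (n + n) → Set where
    own   : ∀ i → Relative σ (vtx σ i)
    other : ∀ i → Relative σ (vtx (not σ) i)

  relative : ∀ σ u → Relative σ u
  relative σ u with toVertex u
  relative true  _ | vertex true  i = own i
  relative true  _ | vertex false i = other i
  relative false _ | vertex true  i = other i
  relative false _ | vertex false i = own i

  sided : ∀ {A : Set} → Bool → Vec A n → Vec A n → Vec A (n + n)
  sided true  xs ys = xs ++ ys
  sided false xs ys = ys ++ xs

  lookup-sided-own : ∀ {A : Set} σ (xs ys : Vec A n) i → lookup (sided σ xs ys) (vtx σ i) ≡ lookup xs i
  lookup-sided-own true  xs ys i = lookup-++ˡ xs ys i
  lookup-sided-own false xs ys i = lookup-++ʳ ys xs i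

  lookup-sided-other : ∀ {A : Set} σ (xs ys : Vec A n) i →
    lookup (sided σ xs ys) (vtx (not σ) i) ≡ lookup ys i
  lookup-sided-other true  xs ys i = lookup-++ʳ xs ys i
  lookup-sided-other false xs ys i = lookup-++ˡ ys xs i

  ∣sided∣ : ∀ σ (p q : Subset n) → ∣ sided σ p q ∣ ≡ ∣ p ∣ + ∣ q ∣
  ∣sided∣ true  p q = ∣p++q∣≡∣p∣+∣q∣ p q
  ∣sided∣ false p q = trans (∣p++q∣≡∣p∣+∣q∣ q p) (+-comm ∣ q ∣ ∣ p ∣)

  ∈-sided-own : ∀ σ {p q i} → vtx σ i ∈ sided σ p q ⇔ i ∈ p
  ∈-sided-own σ {p} {q} {i} = lookup≡⇒∈⇔∈ (lookup-sided-own σ p q i)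

  ∈-sided-other : ∀ σ {p q i} → vtx (not σ) i ∈ sided σ p q ⇔ i ∈ q
  ∈-sided-other σ {p} {q} {i} = lookup≡⇒∈⇔∈ (lookup-sided-other σ p q i)

module _ (n : ℕ) (M : Subset n) where
  open Prism n

  private
    G : Graph (n + n)
    G = KnP2Minus n M

  G-own : ∀ σ i j → G (vtx σ i) (vtx σ j) ≡ not ⌊ i ≟ j ⌋
  G-own true  i j rewrite splitAt-↑ˡ n i n | splitAt-↑ˡ n j n = refl
  G-own false i j rewrite splitAt-↑ʳ n n i | splitAt-↑ʳ n n j = refl

  G-other : ∀ σ i j → G (vtx σ i) (vtx (not σ) j) ≡ ⌊ i ≟ j ⌋ ∧ lookup M i
  G-other true  i j rewrite splitAt-↑ˡ n i n | splitAt-↑ʳ n n j = refl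
  G-other false i j rewrite splitAt-↑ʳ n n i | splitAt-↑ˡ n j n = refl

  G-other⁻ : ∀ σ i j → G (vtx (not σ) i) (vtx σ j) ≡ ⌊ i ≟ j ⌋ ∧ lookup M i
  G-other⁻ true  = G-other false
  G-other⁻ false = G-other true

  private
    ≟∧-true : ∀ {i j : Fin n} {b} → ⌊ i ≟ j ⌋ ∧ b ≡ true → i ≡ j × b ≡ true
    ≟∧-true {i} {j} h with i ≟ j
    ... | yes i≡j = i≡j , h

    not≟-true : ∀ {i j : Fin n} → not ⌊ i ≟ j ⌋ ≡ true → i ≢ j
    not≟-true {i} {j} h with i ≟ j
    ... | no i≢j = i≢j

    ≢⇒not≟-true : ∀ {i j : Fin n} → i ≢ j → not ⌊ i ≟ j ⌋ ≡ true
    ≢⇒not≟-true {i} {j} i≢j with i ≟ j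
    ... | yes i≡j = ⊥-elim (i≢j i≡j)
    ... | no _    = refl

    ≟∧-refl : ∀ {i : Fin n} {b} → b ≡ true → ⌊ i ≟ i ⌋ ∧ b ≡ true
    ≟∧-refl {i} b≡true with i ≟ i
    ... | yes _   = b≡true
    ... | no i≢i = ⊥-elim (i≢i refl)

  Adj-own⇒≢ : ∀ {σ i j} → Adj G (vtx σ i) (vtx σ j) → i ≢ j
  Adj-own⇒≢ {σ} {i} {j} adj = not≟-true (trans (sym (G-own σ i j)) adj)

  Adj-other⇒matched : ∀ {σ i j} → Adj G (vtx σ i) (vtx (not σ) j) → i ≡ j × i ∈ M
  Adj-other⇒matched {σ} {i} {j} adj with ≟∧-true (trans (sym (G-other σ i j)) adj)
  ... | i≡j , Mi = i≡j , lookup⇒[]= i M Mi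

  Adj-other⁻⇒matched : ∀ {σ i j} → Adj G (vtx (not σ) i) (vtx σ j) → i ≡ j × i ∈ M
  Adj-other⁻⇒matched {σ} {i} {j} adj with ≟∧-true (trans (sym (G-other⁻ σ i j)) adj)
  ... | i≡j , Mi = i≡j , lookup⇒[]= i M Mi

  matchingEdge : ∀ σ {i} → i ∈ M → Adj G (vtx σ i) (vtx (not σ) i)
  matchingEdge σ {i} i∈M = trans (G-other σ i i) (≟∧-refl ([]=⇒lookup i∈M))

  side-TwoCliqueCover : TwoCliqueCover G side
  side-TwoCliqueCover u v su≡sv with toVertex u
  ... | vertex σ i with relative σ v
  ...   | other j = ⊥-elim (side-own≢other σ i j su≡sv)
  ...   | own j with i ≟ j
  ...     | yes refl = inj₁ refl
  ...     | no i≢j   = inj₂ (trans (G-own σ i j) (≢⇒not≟-true i≢j))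

  matchNeighbours : Fin n → Subset n
  matchNeighbours i = tabulate (λ j → ⌊ i ≟ j ⌋ ∧ lookup M i)

  matchNeighbours-matched : ∀ {i} → i ∈ M → matchNeighbours i ≡ ⁅ i ⁆
  matchNeighbours-matched {i} i∈M =
    trans (tabulate-cong (λ j → trans (cong (⌊ i ≟ j ⌋ ∧_) ([]=⇒lookup i∈M)) (∧-identityʳ _))) (tabulate-≟ i)

  matchNeighbours-unmatched : ∀ {i} → i ∉ M → matchNeighbours i ≡ ∅
  matchNeighbours-unmatched {i} i∉M =
    trans (tabulate-cong (λ j → trans (cong (⌊ i ≟ j ⌋ ∧_) (∉⇒lookup≡false i∉M)) (∧-zeroʳ _))) (tabulate-false n)

  deg-split : ∀ σ i →
    deg G (vtx σ i) ≡ ∣ tabulate (G (vtx σ i) ∘ vtx σ) ∣ + ∣ tabulate (G (vtx σ i) ∘ vtx (not σ)) ∣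
  deg-split true  i = trans (cong ∣_∣ (tabulate-++ n (G (vtx true i))))
                            (∣p++q∣≡∣p∣+∣q∣ (tabulate (G (vtx true i) ∘ vtx true))
                                            (tabulate (G (vtx true i) ∘ vtx false)))
  deg-split false i = trans (cong ∣_∣ (tabulate-++ n (G (vtx false i))))
                            (trans (∣p++q∣≡∣p∣+∣q∣ across along) (+-comm ∣ across ∣ ∣ along ∣))
    where
    along across : Subset n
    along  = tabulate (G (vtx false i) ∘ vtx false)
    across = tabulate (G (vtx false i) ∘ vtx true)

  deg-vtx : ∀ σ i → deg G (vtx σ i) ≡ (n ∸ 1) + ∣ matchNeighbours i ∣
  deg-vtx σ i = begin
    deg G (vtx σ i)
      ≡⟨ deg-split σ i ⟩
    ∣ tabulate (G (vtx σ i) ∘ vtx σ) ∣ + ∣ tabulate (G (vtx σ i) ∘ vtx (not σ)) ∣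
      ≡⟨ cong₂ (λ p q → ∣ p ∣ + ∣ q ∣) (tabulate-cong (G-own σ i)) (tabulate-cong (G-other σ i)) ⟩
    ∣ tabulate (not ∘ (λ j → ⌊ i ≟ j ⌋)) ∣ + ∣ matchNeighbours i ∣
      ≡⟨ cong (λ p → ∣ p ∣ + ∣ matchNeighbours i ∣)
              (trans (tabulate-∘ not (λ j → ⌊ i ≟ j ⌋)) (cong ∁ (tabulate-≟ i))) ⟩
    ∣ ∁ ⁅ i ⁆ ∣ + ∣ matchNeighbours i ∣
      ≡⟨ cong (_+ ∣ matchNeighbours i ∣) (trans (∣∁p∣≡n∸∣p∣ ⁅ i ⁆) (cong (n ∸_) (∣⁅x⁆∣≡1 i))) ⟩
    (n ∸ 1) + ∣ matchNeighbours i ∣ ∎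
    where open ≡-Reasoning

  deg-matched : ∀ σ {i} → i ∈ M → deg G (vtx σ i) ≡ n
  deg-matched σ {i} i∈M = begin
    deg G (vtx σ i)                  ≡⟨ deg-vtx σ i ⟩
    (n ∸ 1) + ∣ matchNeighbours i ∣  ≡⟨ cong (λ p → (n ∸ 1) + ∣ p ∣) (matchNeighbours-matched i∈M) ⟩
    (n ∸ 1) + ∣ ⁅ i ⁆ ∣              ≡⟨ cong (λ k → (n ∸ 1) + k) (∣⁅x⁆∣≡1 i) ⟩
    (n ∸ 1) + 1                      ≡⟨ +-comm (n ∸ 1) 1 ⟩
    suc (n ∸ 1)                      ≡⟨ suc-pred n {{nonZeroIndex i}} ⟩
    n                                ∎
    where open ≡-Reasoning

  deg-unmatched : ∀ σ {i} → i ∉ M → deg G (vtx σ i) ≡ n ∸ 1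
  deg-unmatched σ {i} i∉M = begin
    deg G (vtx σ i)                  ≡⟨ deg-vtx σ i ⟩
    (n ∸ 1) + ∣ matchNeighbours i ∣  ≡⟨ cong (λ p → (n ∸ 1) + ∣ p ∣) (matchNeighbours-unmatched i∉M) ⟩
    (n ∸ 1) + ∣ ∅ {n} ∣              ≡⟨ cong (λ k → (n ∸ 1) + k) (∣⊥∣≡0 n) ⟩
    (n ∸ 1) + 0                      ≡⟨ +-identityʳ (n ∸ 1) ⟩
    n ∸ 1                            ∎
    where open ≡-Reasoning

  minDegree : ∣ M ∣ < n → IsMinDegree G (n ∸ 1)
  minDegree ∣M∣<n = n∸1≤deg , witness
    where
    witness : ∃ λ v → deg G v ≡ n ∸ 1
    witness with ∣p∣<n⇒Nonempty∁p M ∣M∣<n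
    ... | j₀ , j₀∈∁M = vtx true j₀ , deg-unmatched true (x∈∁p⇒x∉p j₀∈∁M)
    n∸1≤deg : ∀ v → n ∸ 1 ≤ deg G v
    n∸1≤deg v with toVertex v
    ... | vertex σ i with i ∈? M
    ...   | yes i∈M = subst (n ∸ 1 ≤_) (sym (deg-matched σ i∈M)) (m∸n≤m n 1)
    ...   | no  i∉M = ≤-reflexive (sym (deg-unmatched σ i∉M))

  maxDegree : 0 < ∣ M ∣ → IsMaxDegree G n
  maxDegree 0<∣M∣ = deg≤n , witness
    where
    witness : ∃ λ v → deg G v ≡ n
    witness with 0<∣p∣⇒Nonempty M 0<∣M∣
    ... | j₁ , j₁∈M = vtx true j₁ , deg-matched true j₁∈M
    deg≤n : ∀ v → deg G v ≤ n
    deg≤n v with toVertex v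
    ... | vertex σ i with i ∈? M
    ...   | yes i∈M = ≤-reflexive (deg-matched σ i∈M)
    ...   | no  i∉M = subst (_≤ n) (sym (deg-unmatched σ i∉M)) (m∸n≤m n 1)

  CrossEdgesIn : Graph (n + n) → Subset n → Set
  CrossEdgesIn H P = ∀ u w → Adj H u w → side u ≢ side w →
    ∃ λ x → x ∈ P × Ends (vtx true x) (vtx false x) u w

  Ends-matching : ∀ σ {x u w} → Ends (vtx σ x) (vtx (not σ) x) u w ⇔ Ends (vtx true x) (vtx false x) u w
  Ends-matching true  = mk⇔ id id
  Ends-matching false = mk⇔ Sum.swap Sum.swap

  crossEdges : CrossEdgesIn G M
  crossEdges u w u~w su≢sw with toVertex u
  ... | vertex σ i with relative σ w
  ...   | own j = ⊥-elim (su≢sw (trans (side-vtx σ i) (sym (side-vtx σ j))))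
  ...   | other j with Adj-other⇒matched {σ} {i} {j} u~w
  ...     | refl , i∈M = i , i∈M , Equivalence.to (Ends-matching σ) (inj₁ (refl , refl))

  removeMatchingEdge-crossEdges : ∀ {H P} σ i → CrossEdgesIn H P →
    CrossEdgesIn (removeEdge H (vtx σ i) (vtx (not σ) i)) (P - i)
  removeMatchingEdge-crossEdges {H} σ i crossH u w u~w su≢sw
    with Equivalence.to (removeEdge-Adj {G = H}) u~w
  ... | u~Hw , ¬ends with crossH u w u~Hw su≢sw
  ...   | x , x∈P , ends with x ≟ i
  ...     | yes refl = ⊥-elim (¬ends (Equivalence.from (Ends-matching σ) ends))
  ...     | no x≢i   = x , x∈p∧x≢y⇒x∈p-y x∈P x≢i , ends

  firstCopy : Subset n → Subset (n + n)
  firstCopy P = sided true P ∅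

  firstCopy⇒twoComponents : ∀ {H P j} → TwoCliqueCover H side → CrossEdgesIn H P → j ∉ P →
    Components H (firstCopy P) 2
  firstCopy⇒twoComponents {H} {P} {j} cover crossH j∉P =
    sides⇒twoComponents cover sameSide
      (vtx false j , (λ j∈∅ → ∉⊥ (Equivalence.to (∈-sided-other true {P}) j∈∅)) , side-vtx false j)
      (vtx true j  , (λ j∈P → j∉P (Equivalence.to (∈-sided-own true {q = ∅}) j∈P))   , side-vtx true j)
    where
    sameSide : ∀ u w → Adj H u w → u ∉ firstCopy P → w ∉ firstCopy P → side u ≡ side w
    sameSide u w u~w u∉S w∉S with side u ≟ᵇ side w
    ... | yes su≡sw = su≡sw
    ... | no su≢sw with crossH u w u~w su≢sw
    ...   | x , x∈P , inj₁ (refl , refl) = ⊥-elim (u∉S (Equivalence.from (∈-sided-own true {q = ∅}) x∈P))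
    ...   | x , x∈P , inj₂ (refl , refl) = ⊥-elim (w∉S (Equivalence.from (∈-sided-own true {q = ∅}) x∈P))

  twoComponents⇒∣M∣≤∣S∣ : ∀ S → Components G S 2 → ∣ M ∣ ≤ ∣ S ∣
  twoComponents⇒∣M∣≤∣S∣ S C with Vec.splitAt n S
  ... | p , q , refl = begin
    ∣ M ∣          ≤⟨ p⊆q⇒∣p∣≤∣q∣ M⊆p∪q ⟩
    ∣ p ∪ q ∣      ≤⟨ ∣p∪q∣≤∣p∣+∣q∣ p q ⟩
    ∣ p ∣ + ∣ q ∣  ≡⟨ ∣p++q∣≡∣p∣+∣q∣ p q ⟨
    ∣ p ++ q ∣     ∎
    where
    open ≤-Reasoning
    M⊆p∪q : M ⊆ p ∪ q
    M⊆p∪q {x} x∈M = x∈p∪q⁺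
      (Sum.map (Equivalence.to (∈-sided-own true {q = q})) (Equivalence.to (∈-sided-other true {p}))
        (twoComponents⇒crossEdge∩S side-TwoCliqueCover C (matchingEdge true x∈M) (side-own≢other true x x)))

  components-bound : ∀ S k → Components G S k → k ≤ 1 ⊎ k * ∣ M ∣ ≤ ∣ S ∣ * 2
  components-bound S 0 C = inj₁ z≤n
  components-bound S 1 C = inj₁ ≤-refl
  components-bound S 2 C =
    inj₂ (≤-trans (*-monoʳ-≤ 2 (twoComponents⇒∣M∣≤∣S∣ S C)) (≤-reflexive (*-comm 2 ∣ S ∣)))
  components-bound S (suc (suc (suc k))) C with TwoCliqueCover⇒components≤2 side-TwoCliqueCover C
  ... | s≤s (s≤s ())

  ∣firstCopy∣ : ∀ P → ∣ firstCopy P ∣ ≡ ∣ P ∣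
  ∣firstCopy∣ P = trans (∣sided∣ true P ∅) (trans (cong (_+_ ∣ P ∣) (∣⊥∣≡0 n)) (+-identityʳ ∣ P ∣))

  ¬Tough-aboveHalf : ∣ M ∣ < n → ∀ t (pos : 0ℚ <ℚ t) → + ∣ M ∣ / 2 <ℚ t → ¬ Tough G t pos
  ¬Tough-aboveHalf ∣M∣<n t pos m/2<t with ∣p∣<n⇒Nonempty∁p M ∣M∣<n
  ... | j₀ , j₀∈∁M =
    ¬Tough pos (firstCopy⇒twoComponents side-TwoCliqueCover crossEdges (x∈∁p⇒x∉p j₀∈∁M)) (s≤s (s≤s z≤n))
      (ℚP.≤-<-trans (ℕtoℚ≤ℕtoℚ*half {2} {∣ M ∣} {∣ firstCopy M ∣} (≤-reflexive ∣S∣*2≡2∣M∣))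
                    (ℚP.*-monoʳ-<-pos (ℕtoℚ 2) m/2<t))
    where
    ∣S∣*2≡2∣M∣ : ∣ firstCopy M ∣ * 2 ≡ 2 * ∣ M ∣
    ∣S∣*2≡2∣M∣ = trans (cong (_* 2) (∣firstCopy∣ M)) (*-comm ∣ M ∣ 2)

  ¬Tough-removeMatchingEdge : ∀ σ {i} → i ∈ M → ∣ M ∣ < n → (pos : 0ℚ <ℚ + ∣ M ∣ / 2) →
    ¬ Tough (removeEdge G (vtx σ i) (vtx (not σ) i)) (+ ∣ M ∣ / 2) pos
  ¬Tough-removeMatchingEdge σ {i} i∈M ∣M∣<n pos with ∣p∣<n⇒Nonempty∁p M ∣M∣<n
  ... | j₀ , j₀∈∁M =
    ¬Tough pos (firstCopy⇒twoComponents cover (removeMatchingEdge-crossEdges σ i crossEdges) j₀∉M-i)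
      (s≤s (s≤s z≤n))
      (ℕtoℚ<ℕtoℚ*half {2} {∣ M ∣} {∣ firstCopy (M - i) ∣} ∣S∣*2<2∣M∣)
    where
    cover : TwoCliqueCover (removeEdge G (vtx σ i) (vtx (not σ) i)) side
    cover = removeEdge-TwoCliqueCover side-TwoCliqueCover (side-own≢other σ i i)
    j₀∉M-i : j₀ ∉ M - i
    j₀∉M-i j₀∈M-i = x∈∁p⇒x∉p j₀∈∁M (p─q⊆p M ⁅ i ⁆ j₀∈M-i)
    ∣S∣*2<2∣M∣ : ∣ firstCopy (M - i) ∣ * 2 < 2 * ∣ M ∣
    ∣S∣*2<2∣M∣ = subst₂ (λ a b → a * 2 < b) (sym (∣firstCopy∣ (M - i))) (*-comm ∣ M ∣ 2)
                        (*-monoˡ-< 2 (x∈p⇒∣p-x∣<∣p∣ i∈M))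

  -- The cut for a deleted clique edge v_{σ,i}v_{σ,j}: copy σ except v_{σ,i}, v_{σ,j},
  -- plus v_{¬σ,i}, v_{¬σ,j}.
  module CliqueEdgeCut (σ : Bool) {i j : Fin n} (i≢j : i ≢ j) where

    H : Graph (n + n)
    H = removeEdge G (vtx σ i) (vtx σ j)

    E : Subset n
    E = ⁅ i ⁆ ∪ ⁅ j ⁆

    S : Subset (n + n)
    S = sided σ (∁ E) E

    ℓ : Fin n → Fin 3
    ℓ x = if ⌊ i ≟ x ⌋ then zero else suc zero

    label : Fin (n + n) → Fin 3
    label = lookup (sided σ (tabulate ℓ) (replicate n (suc (suc zero))))

    ∣S∣≡n : ∣ S ∣ ≡ n
    ∣S∣≡n = begin
      ∣ S ∣               ≡⟨ ∣sided∣ σ (∁ E) E ⟩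
      ∣ ∁ E ∣ + ∣ E ∣     ≡⟨ cong (_+ ∣ E ∣) (∣∁p∣≡n∸∣p∣ E) ⟩
      (n ∸ ∣ E ∣) + ∣ E ∣ ≡⟨ m∸n+n≡m (∣p∣≤n E) ⟩
      n                   ∎
      where open ≡-Reasoning

    ∣E∣≤2 : ∣ E ∣ ≤ 2
    ∣E∣≤2 = subst₂ (λ a b → ∣ E ∣ ≤ a + b) (∣⁅x⁆∣≡1 i) (∣⁅x⁆∣≡1 j) (∣p∪q∣≤∣p∣+∣q∣ ⁅ i ⁆ ⁅ j ⁆)

    own∉S⇒∈E : ∀ {x} → vtx σ x ∉ S → x ∈ E
    own∉S⇒∈E x∉S = x∉∁p⇒x∈p (x∉S ∘ Equivalence.from (∈-sided-own σ))

    own∉S⇒ : ∀ {x} → vtx σ x ∉ S → x ≡ i ⊎ x ≡ j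
    own∉S⇒ x∉S = Sum.map (x∈⁅y⁆⇒x≡y i) (x∈⁅y⁆⇒x≡y j) (x∈p∪q⁻ ⁅ i ⁆ ⁅ j ⁆ (own∉S⇒∈E x∉S))

    other∉S⇒∉E : ∀ {x} → vtx (not σ) x ∉ S → x ∉ E
    other∉S⇒∉E x∉S = x∉S ∘ Equivalence.from (∈-sided-other σ)

    ∈E⇒own∉S : ∀ {x} → x ∈ E → vtx σ x ∉ S
    ∈E⇒own∉S x∈E x∈S = x∈∁p⇒x∉p (Equivalence.to (∈-sided-own σ) x∈S) x∈E

    ∉E⇒other∉S : ∀ {x} → x ∉ E → vtx (not σ) x ∉ S
    ∉E⇒other∉S x∉E = x∉E ∘ Equivalence.to (∈-sided-other σ)

    label-own : ∀ x → label (vtx σ x) ≡ ℓ x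
    label-own x = trans (lookup-sided-own σ _ _ x) (lookup∘tabulate ℓ x)

    label-other : ∀ x → label (vtx (not σ) x) ≡ suc (suc zero)
    label-other x = trans (lookup-sided-other σ (tabulate ℓ) _ x) (lookup-replicate x _)

    ℓ-i : ℓ i ≡ zero
    ℓ-i with i ≟ i
    ... | yes _   = refl
    ... | no i≢i = ⊥-elim (i≢i refl)

    ℓ-j : ℓ j ≡ suc zero
    ℓ-j with i ≟ j
    ... | yes i≡j = ⊥-elim (i≢j i≡j)
    ... | no _    = refl

    ℓ≢2 : ∀ x → ℓ x ≢ suc (suc zero)
    ℓ≢2 x with i ≟ x
    ... | yes _ = λ ()
    ... | no _  = λ ()

    own-label : ∀ {x y} → label (vtx σ x) ≡ label (vtx σ y) → ℓ x ≡ ℓ y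
    own-label {x} {y} eq = trans (sym (label-own x)) (trans eq (label-own y))

    own≢other-label : ∀ x y → label (vtx σ x) ≢ label (vtx (not σ) y)
    own≢other-label x y eq = ℓ≢2 x (trans (sym (label-own x)) (trans eq (label-other y)))

    edge⇒sameLabel : ∀ u w → Adj H u w → u ∉ S → w ∉ S → label u ≡ label w
    edge⇒sameLabel u w u~w u∉S w∉S
      with Equivalence.to (removeEdge-Adj {G = G}) u~w | relative σ u | relative σ w
    ... | u~Gw , ¬ends | own x | own y with own∉S⇒ u∉S | own∉S⇒ w∉S
    ...   | inj₁ refl | inj₁ refl = ⊥-elim (Adj-own⇒≢ {σ} u~Gw refl)
    ...   | inj₁ refl | inj₂ refl = ⊥-elim (¬ends (inj₁ (refl , refl)))
    ...   | inj₂ refl | inj₁ refl = ⊥-elim (¬ends (inj₂ (refl , refl)))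
    ...   | inj₂ refl | inj₂ refl = ⊥-elim (Adj-own⇒≢ {σ} u~Gw refl)
    edge⇒sameLabel _ _ _ u∉S w∉S | u~Gw , _ | own x | other y with Adj-other⇒matched {σ} {x} {y} u~Gw
    ... | refl , _ = ⊥-elim (other∉S⇒∉E w∉S (own∉S⇒∈E u∉S))
    edge⇒sameLabel _ _ _ u∉S w∉S | u~Gw , _ | other x | own y with Adj-other⁻⇒matched {σ} {x} {y} u~Gw
    ... | refl , _ = ⊥-elim (other∉S⇒∉E u∉S (own∉S⇒∈E w∉S))
    edge⇒sameLabel _ _ _ _ _ | _ | other x | other y = trans (label-other x) (sym (label-other y))

    sameLabel⇒clique : ∀ u v → u ∉ S → v ∉ S → label u ≡ label v → u ≡ v ⊎ Adj H u v
    sameLabel⇒clique u v u∉S v∉S lu≡lv with relative σ u | relative σ v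
    ... | own x | own y with own∉S⇒ u∉S | own∉S⇒ v∉S
    ...   | inj₁ refl | inj₁ refl = inj₁ refl
    ...   | inj₂ refl | inj₂ refl = inj₁ refl
    ...   | inj₁ refl | inj₂ refl with () ← trans (sym ℓ-i) (trans (own-label lu≡lv) ℓ-j)
    ...   | inj₂ refl | inj₁ refl with () ← trans (sym ℓ-i) (trans (own-label (sym lu≡lv)) ℓ-j)
    sameLabel⇒clique _ _ _ _ lu≡lv | own x | other y = ⊥-elim (own≢other-label x y lu≡lv)
    sameLabel⇒clique _ _ _ _ lu≡lv | other x | own y = ⊥-elim (own≢other-label y x (sym lu≡lv))
    sameLabel⇒clique u v _ _ _ | other x | other y
      with side-TwoCliqueCover u v (trans (side-vtx (not σ) x) (sym (side-vtx (not σ) y)))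
    ... | inj₁ u≡v  = inj₁ u≡v
    ... | inj₂ u~Gv = inj₂ (Equivalence.from (removeEdge-Adj {G = G}) (u~Gv , ¬ends))
      where
      ¬ends : ¬ Ends (vtx σ i) (vtx σ j) (vtx (not σ) x) (vtx (not σ) y)
      ¬ends (inj₁ (u≡ , _)) = vtx-other≢vtx σ u≡
      ¬ends (inj₂ (u≡ , _)) = vtx-other≢vtx σ u≡

    components : 3 ≤ n → Components H S 3
    components 3≤n = labelling⇒Components label edge⇒sameLabel sameLabel⇒clique hit
      where
      i∈E : i ∈ E
      i∈E = x∈p∪q⁺ (inj₁ (x∈⁅x⁆ i))
      j∈E : j ∈ E
      j∈E = x∈p∪q⁺ (inj₂ (x∈⁅x⁆ j))
      hit : ∀ y → ∃ λ u → u ∉ S × label u ≡ y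
      hit zero             = vtx σ i , ∈E⇒own∉S i∈E , trans (label-own i) ℓ-i
      hit (suc zero)       = vtx σ j , ∈E⇒own∉S j∈E , trans (label-own j) ℓ-j
      hit (suc (suc zero)) with ∣p∣<n⇒Nonempty∁p E (≤-trans (s≤s ∣E∣≤2) 3≤n)
      ... | x₀ , x₀∈∁E = vtx (not σ) x₀ , ∉E⇒other∉S (x∈∁p⇒x∉p x₀∈∁E) , label-other x₀

  ¬Tough-removeCliqueEdge : ∀ σ {i j} → i ≢ j → 3 ≤ n → 2 * n < 3 * ∣ M ∣ → (pos : 0ℚ <ℚ + ∣ M ∣ / 2) →
    ¬ Tough (removeEdge G (vtx σ i) (vtx σ j)) (+ ∣ M ∣ / 2) pos
  ¬Tough-removeCliqueEdge σ i≢j 3≤n 2n<3m pos =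
    ¬Tough pos (components 3≤n) (s≤s (s≤s z≤n)) (ℕtoℚ<ℕtoℚ*half {3} {∣ M ∣} {∣ S ∣} ∣S∣*2<3∣M∣)
    where
    open CliqueEdgeCut σ i≢j
    ∣S∣*2<3∣M∣ : ∣ S ∣ * 2 < 3 * ∣ M ∣
    ∣S∣*2<3∣M∣ = subst (λ s → s * 2 < 3 * ∣ M ∣) (sym ∣S∣≡n) (subst (_< 3 * ∣ M ∣) (*-comm 2 n) 2n<3m)

  removeEdge-¬Tough : ∣ M ∣ < n → 3 ≤ n → 2 * n < 3 * ∣ M ∣ → (pos : 0ℚ <ℚ + ∣ M ∣ / 2) →
    ∀ a b → Adj G a b → ¬ Tough (removeEdge G a b) (+ ∣ M ∣ / 2) pos
  removeEdge-¬Tough ∣M∣<n 3≤n 2n<3m pos a b a~b with toVertex a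
  ... | vertex σ i with relative σ b
  ...   | own j   = ¬Tough-removeCliqueEdge σ (Adj-own⇒≢ {σ} a~b) 3≤n 2n<3m pos
  ...   | other j with Adj-other⇒matched {σ} {i} {j} a~b
  ...     | refl , i∈M = ¬Tough-removeMatchingEdge σ i∈M ∣M∣<n pos

mainTheorem3 : (n m : ℕ) → 1 ≤ m → 2 * n < 3 * m → m < n → 7 ≤ n →
    (M : Subset n) → ∣ M ∣ ≡ m →
    (pos : 0ℚ <ℚ (+ m / 2)) →
    ClawFree (KnP2Minus n M) ×
    MinimallyTough (KnP2Minus n M) (+ m / 2) pos ×
    IsMinDegree (KnP2Minus n M) (n ∸ 1) ×
    IsMaxDegree (KnP2Minus n M) n
mainTheorem3 n .(∣ M ∣) 1≤m 2n<3m m<n 7≤n M refl pos =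
  TwoCliqueCover⇒ClawFree (side-TwoCliqueCover n M) ,
  ((Tough-half pos (components-bound n M) , ¬Tough-aboveHalf n M m<n) ,
   removeEdge-¬Tough n M m<n 3≤n 2n<3m pos) ,
  minDegree n M m<n ,
  maxDegree n M 1≤m
  where
  -- only n ≥ 3 is needed
  3≤n : 3 ≤ n
  3≤n = ≤-trans (s≤s (s≤s (s≤s z≤n))) 7≤n
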